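{- There is an absolute constant $c>0$ such that for every Halin graph $H=T\cup C$ whose characteristic tree $T$ has $p$ leaves and, rooted at some vertex, has depth $d$, the number of spanning trees of $H$ is at most $c\,(2pd)^p$; i.e., the number of spanning trees of $H$ is $O((2pd)^p)$.
   Context: A Halin graph $H=T\cup C$ is obtained from a tree $T$ (the characteristic tree) that has no vertex of degree two and at least three leaves, by adding a cycle $C$ (the accompanying cycle) through all leaves of $T$, in the cyclic order of a plane embedding of $T$. For a rooted tree $T$, its depth is the length (number of edges) of a longest path from the root to a leaf. -}

module Defs where

open import Data.Nat using (ℕ; zero; suc; _+_; _*_; _^_; _≤_; _<_)
open import Data.Nat.DivMod using (_%_; m%n<n)
open import Data.Fin using (Fin; toℕ; fromℕ<; _≟_)
open import Data.Bool using (Bool; true; false; if_then_else_; _∧_; _∨_)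
open import Data.List using (List; []; _∷_; map; length)
open import Data.Bool.ListAction using (any)
open import Data.Nat.ListAction using (sum)
open import Data.List.Relation.Unary.Unique.Propositional using (Unique)
open import Data.List.Relation.Unary.All using (All)
open import Data.List.Relation.Unary.AllPairs using (AllPairs)
open import Data.Product using (Σ; ∃; _×_; _,_; proj₂)
open import Relation.Nullary using (¬_)
open import Data.Empty using (⊥)
open import Relation.Nullary.Decidable using (⌊_⌋)
open import Relation.Binary.PropositionalEquality using (_≡_; _≢_)
open import Data.List using (allFin) public

-- Simple graphs on the vertex set Fin n, given by a Boolean adjacency
-- relation (symmetry / irreflexivity are imposed separately).

Graph : ℕ → Set
Graph n = Fin n → Fin n → Bool

Adj : ∀ {n} → Graph n → Fin n → Fin n → Set
Adj G u v = G u v ≡ true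

IsSimple : ∀ {n} → Graph n → Set
IsSimple G = (∀ u v → G u v ≡ G v u) × (∀ u → G u u ≡ false)

deg : ∀ {n} → Graph n → Fin n → ℕ
deg {n} G v = sum (map (λ u → if G v u then 1 else 0) (allFin n))

IsLeaf : ∀ {n} → Graph n → Fin n → Set
IsLeaf G v = deg G v ≡ 1

data Walk {n} (G : Graph n) : Fin n → Fin n → Set where
  stop : ∀ u → Walk G u u
  step : ∀ {u v w} → Adj G u v → Walk G v w → Walk G u w

verts : ∀ {n} {G : Graph n} {u v} → Walk G u v → List (Fin n)
verts (stop u) = u ∷ []
verts (step {u = u} _ w) = u ∷ verts w

len : ∀ {n} {G : Graph n} {u v} → Walk G u v → ℕ
len (stop _) = 0
len (step _ w) = suc (len w)

IsPath : ∀ {n} {G : Graph n} {u v} → Walk G u v → Set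
IsPath w = Unique (verts w)

Connected : ∀ {n} → Graph n → Set
Connected G = ∀ u v → Walk G u v

Acyclic : ∀ {n} → Graph n → Set
Acyclic G = ∀ u v → Adj G u v → (w : Walk G v u) → IsPath w → 2 ≤ len w → ⊥

IsTree : ∀ {n} → Graph n → Set
IsTree G = IsSimple G × Connected G × Acyclic G

-- Plane embeddings of a tree, as rotation systems.
-- ρ v is the cyclic successor map on the neighbours of v.

iter : ∀ {A : Set} → (A → A) → ℕ → A → A
iter f zero a = a
iter f (suc k) a = f (iter f k a)

IsRotation : ∀ {n} → Graph n → (Fin n → Fin n → Fin n) → Set
IsRotation T ρ =
  (∀ v u → Adj T v u → Adj T v (ρ v u)) ×
  (∀ v u w → Adj T v u → Adj T v w → ∃ λ k → iter (ρ v) (suc k) u ≡ w)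

-- face-tracing step on darts (u , v) (directed edges u → v)
faceStep : ∀ {n} → (Fin n → Fin n → Fin n) → Fin n × Fin n → Fin n × Fin n
faceStep ρ (u , v) = (v , ρ v u)

next : ∀ {p} → Fin p → Fin p
next {suc m} i = fromℕ< (m%n<n (suc (toℕ i)) (suc m))

-- ℓ lists the leaves in the cyclic order of the embedding ρ: after
-- arriving at the leaf ℓ i, the boundary walk of the (unique) face next
-- meets a leaf at ℓ (next i).
LeafOrder : ∀ {n p} → Graph n → (Fin n → Fin n → Fin n) → (Fin p → Fin n) → Set
LeafOrder T ρ ℓ =
  ∀ i x → Adj T x (ℓ i) →
    ∃ λ k → (proj₂ (iter (faceStep ρ) (suc k) (x , ℓ i)) ≡ ℓ (next i)) ×
            (∀ j → j < k → ¬ IsLeaf T (proj₂ (iter (faceStep ρ) (suc j) (x , ℓ i))))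

IsHalinFrame : ∀ {n p} → Graph n → (Fin p → Fin n) → Set
IsHalinFrame {n} {p} T ℓ =
  IsTree T ×
  (∀ v → deg T v ≢ 2) ×
  3 ≤ p ×
  (∀ i j → ℓ i ≡ ℓ j → i ≡ j) ×
  (∀ i → IsLeaf T (ℓ i)) ×
  (∀ v → IsLeaf T v → ∃ λ i → ℓ i ≡ v) ×
  (Σ (Fin n → Fin n → Fin n) λ ρ → IsRotation T ρ × LeafOrder T ρ ℓ)

eqᵇ : ∀ {n} → Fin n → Fin n → Bool
eqᵇ u v = ⌊ u ≟ v ⌋

cycleAdj : ∀ {n p} → (Fin p → Fin n) → Graph n
cycleAdj {p = p} ℓ u v =
  any (λ i → (eqᵇ u (ℓ i) ∧ eqᵇ v (ℓ (next i))) ∨ (eqᵇ v (ℓ i) ∧ eqᵇ u (ℓ (next i))))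
      (allFin p)

halin : ∀ {n p} → Graph n → (Fin p → Fin n) → Graph n
halin T ℓ u v = T u v ∨ cycleAdj ℓ u v

IsSpanningTreeOf : ∀ {n} → Graph n → Graph n → Set
IsSpanningTreeOf H S = (∀ u v → Adj S u v → Adj H u v) × IsTree S

DifferentGraphs : ∀ {n} → Graph n → Graph n → Set
DifferentGraphs S S' = ∃ λ u → ∃ λ v → S u v ≢ S' u v

Depth : ∀ {n} → Graph n → Fin n → ℕ → Set
Depth T r d =
  (∀ v → IsLeaf T v → (w : Walk T r v) → IsPath w → len w ≤ d) ×
  (∃ λ v → IsLeaf T v × Σ (Walk T r v) λ w → IsPath w × len w ≡ d)

module Submission where

-- A spanning tree of H is a subgraph of H, so it is determined by its values on the darts
-- (directed edges) of H: the ∑ deg T darts of T and the 2p darts of the cycle. Hence H has at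
-- most 2 ^ (∑ deg T + 2p) spanning trees. As T is a tree, ∑ deg T = 2(n - 1); as it has no
-- vertex of degree 2 and p leaves, 3n ≤ ∑ deg T + 2p. So n ≤ 2p, ∑ deg T ≤ 4p, and the count is
-- at most 64 ^ p. Finally d ≥ 1, and 64 ^ p ≤ 64 ^ 32 · (2pd) ^ p: for p ≤ 32 the constant
-- absorbs 64 ^ p, and beyond that 2pd ≥ 64.

open import Defs
open import Data.Bool using (Bool; true; false; if_then_else_; T; T?; _∧_)
open import Data.Bool.Properties using (T-∧; T-∨; T-≡)
open import Data.Empty using (⊥-elim)
open import Data.Fin using (Fin; zero; suc; punchIn) renaming (_≟_ to _≟ᶠ_)
open import Data.Fin.Properties using (punchIn-injective; punchInᵢ≢i; punchIn-punchOut)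
open import Data.List using (List; []; _∷_; [_]; length; map; tabulate; _++_; concatMap; filterᵇ)
open import Data.List.Properties
  using (length-map; length-++; length-tabulate; length-removeAt′; map-tabulate; map-cong; ∷-injective)
open import Data.List.Membership.Propositional using (_∈_; _∉_; _─_; lose)
open import Data.List.Membership.Propositional.Properties
  using (∈-map⁺; ∈-++⁺ˡ; ∈-++⁺ʳ; ∈-allFin; ∈-concatMap⁺; ∈-filter⁺; ∈-filter⁻; ∈-length)
open import Data.List.Relation.Binary.Subset.Propositional using (_⊆_)
open import Data.List.Relation.Unary.All as All using (All; []; _∷_)
import Data.List.Relation.Unary.All.Properties as All
open import Data.List.Relation.Unary.Any as Any using (here; there)
open import Data.List.Relation.Unary.Any.Properties using (any⁻)
open import Data.List.Relation.Unary.AllPairs using (AllPairs; []; _∷_)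
open import Data.List.Relation.Unary.Unique.Propositional using (Unique)
import Data.List.Relation.Unary.Unique.Propositional.Properties as Unique
open import Data.Nat using (ℕ; zero; suc; _+_; _*_; _^_; _≤_; _<_; z≤n; s≤s; _≡ᵇ_; _≟_; _≤?_; >-nonZero)
open import Data.Nat.Properties
import Data.Nat.ListAction as List
open import Data.Nat.Tactic.RingSolver using (solve-∀)
open import Algebra.Properties.CommutativeMonoid.Sum +-0-commutativeMonoid
  using (sum; sum-syntax; sum-remove; ∑-distrib-+; sum-cong-≗)
open import Data.Product using (Σ; ∃; ∃₂; _×_; _,_; proj₁; proj₂; uncurry)
open import Data.Sum using (_⊎_; inj₁; inj₂; [_,_]′)
open import Function using (_∘_; id; case_of_; Equivalence)
open import Relation.Nullary using (yes; no)
open import Relation.Nullary.Decidable using (toWitness)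
open import Relation.Binary.PropositionalEquality hiding ([_])

indicator : Bool → ℕ
indicator b = if b then 1 else 0

sum-tabulate : ∀ {n} (f : Fin n → ℕ) → List.sum (tabulate f) ≡ sum f
sum-tabulate {zero} f = refl
sum-tabulate {suc n} f = cong (f zero +_) (sum-tabulate (f ∘ suc))

sum-allFin : ∀ {n} (f : Fin n → ℕ) → List.sum (map f (allFin n)) ≡ sum f
sum-allFin f = trans (cong List.sum (map-tabulate id f)) (sum-tabulate f)

∑-mono-≤ : ∀ {n} {f g : Fin n → ℕ} → (∀ i → f i ≤ g i) → sum f ≤ sum g
∑-mono-≤ {zero} _ = z≤n
∑-mono-≤ {suc n} f≤g = +-mono-≤ (f≤g zero) (∑-mono-≤ (f≤g ∘ suc))

∑-const : ∀ n k → ∑[ i < n ] k ≡ n * k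
∑-const zero k = refl
∑-const (suc n) k = cong (k +_) (∑-const n k)

length-filterᵇ : ∀ {A : Set} (p : A → Bool) xs →
                 length (filterᵇ p xs) ≡ List.sum (map (indicator ∘ p) xs)
length-filterᵇ p [] = refl
length-filterᵇ p (x ∷ xs) with p x
... | true = cong suc (length-filterᵇ p xs)
... | false = length-filterᵇ p xs

length-concatMap : ∀ {A B : Set} (f : A → List B) xs →
                   length (concatMap f xs) ≡ List.sum (map (length ∘ f) xs)
length-concatMap f [] = refl
length-concatMap f (x ∷ xs) = trans (length-++ (f x)) (cong (length (f x) +_) (length-concatMap f xs))

map-≡⇒≗ : ∀ {A B : Set} {f g : A → B} xs → map f xs ≡ map g xs → ∀ {x} → x ∈ xs → f x ≡ g x
map-≡⇒≗ (y ∷ ys) eq (here refl) = proj₁ (∷-injective eq)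
map-≡⇒≗ (y ∷ ys) eq (there x∈ys) = map-≡⇒≗ ys (proj₂ (∷-injective eq)) x∈ys

∈-─⁺ : ∀ {A : Set} {x y : A} {ys} (x∈ys : x ∈ ys) → y ∈ ys → y ≢ x → y ∈ ys ─ x∈ys
∈-─⁺ (here refl) (here refl) y≢x = ⊥-elim (y≢x refl)
∈-─⁺ (here _) (there y∈ys) _ = y∈ys
∈-─⁺ (there _) (here y≡z) _ = here y≡z
∈-─⁺ (there x∈ys) (there y∈ys) y≢x = there (∈-─⁺ x∈ys y∈ys y≢x)

Unique-length-≤ : ∀ {A : Set} {xs ys : List A} → Unique xs → xs ⊆ ys → length xs ≤ length ys
Unique-length-≤ {xs = []} _ _ = z≤n
Unique-length-≤ {xs = x ∷ xs} {ys} (x∉xs ∷ unique) xs⊆ys =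
  subst (suc (length xs) ≤_) (sym (length-removeAt′ ys _)) (s≤s (Unique-length-≤ unique xs⊆ys─x))
  where
  xs⊆ys─x : xs ⊆ ys ─ xs⊆ys (here refl)
  xs⊆ys─x y∈xs = ∈-─⁺ _ (xs⊆ys (there y∈xs)) (λ { refl → All.lookup x∉xs y∈xs refl })

bitStrings : ℕ → List (List Bool)
bitStrings zero = [ [] ]
bitStrings (suc m) = map (true ∷_) (bitStrings m) ++ map (false ∷_) (bitStrings m)

length-bitStrings : ∀ m → length (bitStrings m) ≡ 2 ^ m
length-bitStrings zero = refl
length-bitStrings (suc m) = begin
  length (map (true ∷_) bs ++ map (false ∷_) bs)   ≡⟨ length-++ (map (true ∷_) bs) ⟩
  length (map (true ∷_) bs) + length (map (false ∷_) bs)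
                                                   ≡⟨ cong₂ _+_ (length-map _ bs) (length-map _ bs) ⟩
  length bs + length bs                            ≡⟨ cong₂ _+_ (length-bitStrings m) (length-bitStrings m) ⟩
  2 ^ m + 2 ^ m                                    ≡⟨ cong (2 ^ m +_) (sym (+-identityʳ (2 ^ m))) ⟩
  2 ^ suc m                                        ∎
  where
  open ≡-Reasoning
  bs = bitStrings m

∈-bitStrings : ∀ bs → bs ∈ bitStrings (length bs)
∈-bitStrings [] = here refl
∈-bitStrings (true ∷ bs) = ∈-++⁺ˡ (∈-map⁺ (true ∷_) (∈-bitStrings bs))
∈-bitStrings (false ∷ bs) = ∈-++⁺ʳ _ (∈-map⁺ (false ∷_) (∈-bitStrings bs))

Unique-bitStrings-≤ : ∀ m {bss} → Unique bss → All (λ bs → length bs ≡ m) bss → length bss ≤ 2 ^ m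
Unique-bitStrings-≤ m {bss} unique lengths =
  subst (length bss ≤_) (length-bitStrings m) (Unique-length-≤ unique bss⊆)
  where
  bss⊆ : bss ⊆ bitStrings m
  bss⊆ bs∈bss = subst (λ k → _ ∈ bitStrings k) (All.lookup lengths bs∈bss) (∈-bitStrings _)

neighbours : ∀ {n} → Graph n → Fin n → List (Fin n)
neighbours {n} G v = filterᵇ (G v) (allFin n)

module _ {n} (G : Graph n) where

  deg≡∑ : ∀ v → deg G v ≡ ∑[ u < n ] indicator (G v u)
  deg≡∑ v = sum-allFin (λ u → indicator (G v u))

  length-neighbours : ∀ v → length (neighbours G v) ≡ deg G v
  length-neighbours v = length-filterᵇ (G v) (allFin n)

  ∈-neighbours⁺ : ∀ {v u} → Adj G v u → u ∈ neighbours G v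
  ∈-neighbours⁺ {v} {u} e = ∈-filter⁺ (T? ∘ G v) (∈-allFin u) (Equivalence.from T-≡ e)

  ∈-neighbours⁻ : ∀ {v u} → u ∈ neighbours G v → Adj G v u
  ∈-neighbours⁻ {v} u∈ = Equivalence.to T-≡ (proj₂ (∈-filter⁻ (T? ∘ G v) {xs = allFin n} u∈))

  neighbours-unique : ∀ v → Unique (neighbours G v)
  neighbours-unique v = Unique.filter⁺ (T? ∘ G v) (Unique.allFin⁺ n)

  adj⇒deg-pos : ∀ {v u} → Adj G v u → 1 ≤ deg G v
  adj⇒deg-pos {v} e = subst (1 ≤_) (length-neighbours v) (∈-length (∈-neighbours⁺ e))

  leaf-neighbour-unique : ∀ {v x y} → IsLeaf G v → Adj G v x → Adj G v y → x ≡ y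
  leaf-neighbour-unique {v} leaf ex ey =
    singleton (neighbours G v) (trans (length-neighbours v) leaf) (∈-neighbours⁺ ex) (∈-neighbours⁺ ey)
    where
    singleton : ∀ {x y} zs → length zs ≡ 1 → x ∈ zs → y ∈ zs → x ≡ y
    singleton (z ∷ []) _ (here refl) (here refl) = refl

  two-neighbours : ∀ {v} → 2 ≤ deg G v → ∃₂ λ x y → Adj G v x × Adj G v y × x ≢ y
  two-neighbours {v} 2≤deg =
    distinct (neighbours G v) (subst (2 ≤_) (sym (length-neighbours v)) 2≤deg) (neighbours-unique v) ∈-neighbours⁻
    where
    distinct : ∀ zs → 2 ≤ length zs → Unique zs → (∀ {u} → u ∈ zs → Adj G v u) →
               ∃₂ λ x y → Adj G v x × Adj G v y × x ≢ y
    distinct (_ ∷ []) (s≤s ()) _ _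
    distinct (x ∷ y ∷ _) _ ((x≢y ∷ _) ∷ _) adj = x , y , adj (here refl) , adj (there (here refl)) , x≢y

walk⇒neighbour : ∀ {n} {G : Graph n} {a b} → Walk G a b → a ≢ b → ∃ λ x → Adj G a x
walk⇒neighbour (stop _) a≢a = ⊥-elim (a≢a refl)
walk⇒neighbour (step e _) _ = _ , e

module _ {n} {G : Graph n} where

  len≡0⇒≡ : ∀ {a b} (W : Walk G a b) → len W ≡ 0 → a ≡ b
  len≡0⇒≡ (stop _) _ = refl
  len≡0⇒≡ (step _ _) ()

  length-verts : ∀ {a b} (W : Walk G a b) → length (verts W) ≡ suc (len W)
  length-verts (stop _) = refl
  length-verts (step _ W) = cong suc (length-verts W)

  path-length< : ∀ {a b} {P : Walk G a b} → IsPath P → len P < n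
  path-length< {P = P} pathP =
    subst₂ _≤_ (length-verts P) (length-tabulate id) (Unique-length-≤ pathP (λ {x} _ → ∈-allFin x))

  suffixFrom : ∀ {a b y} (W : Walk G a b) → y ∈ verts W → Walk G y b
  suffixFrom (stop _) (here refl) = stop _
  suffixFrom (step e W) (here refl) = step e W
  suffixFrom (step _ W) (there y∈W) = suffixFrom W y∈W

  suffixFrom-path : ∀ {a b y} {P : Walk G a b} (y∈P : y ∈ verts P) → IsPath P → IsPath (suffixFrom P y∈P)
  suffixFrom-path {P = stop _} (here refl) pathP = pathP
  suffixFrom-path {P = step _ _} (here refl) pathP = pathP
  suffixFrom-path {P = step _ P} (there y∈P) (_ ∷ pathP) = suffixFrom-path y∈P pathP

  len-suffixFrom : ∀ {a b y} (W : Walk G a b) (y∈W : y ∈ verts W) → len (suffixFrom W y∈W) ≤ len W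
  len-suffixFrom (stop _) (here refl) = ≤-refl
  len-suffixFrom (step _ _) (here refl) = ≤-refl
  len-suffixFrom (step _ W) (there y∈W) = m≤n⇒m≤1+n (len-suffixFrom W y∈W)

  len-suffixFrom-injective : ∀ {a b x y} (W : Walk G a b) (x∈W : x ∈ verts W) (y∈W : y ∈ verts W) →
                             len (suffixFrom W x∈W) ≡ len (suffixFrom W y∈W) → x ≡ y
  len-suffixFrom-injective (stop _) (here refl) (here refl) _ = refl
  len-suffixFrom-injective (step _ _) (here refl) (here refl) _ = refl
  len-suffixFrom-injective (step _ W) (here refl) (there y∈W) eq =
    ⊥-elim (1+n≰n (subst (_≤ len W) (sym eq) (len-suffixFrom W y∈W)))
  len-suffixFrom-injective (step _ W) (there x∈W) (here refl) eq =
    ⊥-elim (1+n≰n (subst (_≤ len W) eq (len-suffixFrom W x∈W)))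
  len-suffixFrom-injective (step _ W) (there x∈W) (there y∈W) eq = len-suffixFrom-injective W x∈W y∈W eq

  snoc : ∀ {a b y} → Walk G a b → Adj G b y → Walk G a y
  snoc (stop _) e = step e (stop _)
  snoc (step e′ W) e = step e′ (snoc W e)

  len-snoc : ∀ {a b y} (W : Walk G a b) (e : Adj G b y) → len (snoc W e) ≡ suc (len W)
  len-snoc (stop _) e = refl
  len-snoc (step _ W) e = cong suc (len-snoc W e)

  ∈-snoc⁻ : ∀ {a b y x} (W : Walk G a b) (e : Adj G b y) → x ∈ verts (snoc W e) → x ∈ verts W ⊎ x ≡ y
  ∈-snoc⁻ (stop _) e (here refl) = inj₁ (here refl)
  ∈-snoc⁻ (stop _) e (there (here refl)) = inj₂ refl
  ∈-snoc⁻ (step _ W) e (here refl) = inj₁ (here refl)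
  ∈-snoc⁻ (step _ W) e (there x∈) with ∈-snoc⁻ W e x∈
  ... | inj₁ x∈W = inj₁ (there x∈W)
  ... | inj₂ x≡y = inj₂ x≡y

  snoc-path : ∀ {a b y} {P : Walk G a b} (e : Adj G b y) → IsPath P → y ∉ verts P → IsPath (snoc P e)
  snoc-path {P = stop _} e _ y∉P = ((λ { refl → y∉P (here refl) }) ∷ []) ∷ [] ∷ []
  snoc-path {P = step _ P} e (a∉P ∷ pathP) y∉P =
    All.tabulate (λ x∈ → [ All.lookup a∉P , (λ { refl refl → y∉P (here refl) }) ]′ (∈-snoc⁻ P e x∈))
    ∷ snoc-path e pathP (y∉P ∘ there)

module _ {n} {G : Graph n} (simple : IsSimple G) where

  adj-sym : ∀ {u v} → Adj G u v → Adj G v u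
  adj-sym {u} {v} e = trans (proj₁ simple v u) e

  adj⇒≢ : ∀ {u v} → Adj G u v → u ≢ v
  adj⇒≢ {u} e refl with () ← trans (sym e) (proj₂ simple u)

  edge-path : ∀ {a x} (e : Adj G a x) → IsPath {G = G} (step e (stop x))
  edge-path e = (adj⇒≢ e ∷ []) ∷ [] ∷ []

module _ {n} {G : Graph n} (simple : IsSimple G) (acyclic : Acyclic G) where

  open import Data.List.Membership.DecPropositional (_≟ᶠ_ {n}) using (_∈?_)

  -- A neighbour y of the end b of a path, lying on the path, closes a cycle unless it is the
  -- vertex just before b.
  len-suffixFrom-neighbour : ∀ {a b y} {P : Walk G a b} → IsPath P → Adj G b y →
                             (y∈P : y ∈ verts P) → len (suffixFrom P y∈P) ≡ 1
  len-suffixFrom-neighbour {P = P} pathP e y∈P with len (suffixFrom P y∈P) in eq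
  ... | zero = ⊥-elim (adj⇒≢ simple e (sym (len≡0⇒≡ (suffixFrom P y∈P) eq)))
  ... | suc zero = refl
  ... | suc (suc _) = ⊥-elim (acyclic _ _ e (suffixFrom P y∈P) (suffixFrom-path y∈P pathP)
                                         (subst (2 ≤_) (sym eq) (s≤s (s≤s z≤n))))

  neighbour-off-path : ∀ {a b} {P : Walk G a b} → IsPath P → 2 ≤ deg G b →
                       ∃ λ y → Adj G b y × y ∉ verts P
  neighbour-off-path {P = P} pathP 2≤deg with two-neighbours G 2≤deg
  ... | y₁ , y₂ , e₁ , e₂ , y₁≢y₂ with y₁ ∈? verts P | y₂ ∈? verts P
  ...   | no y₁∉P | _       = y₁ , e₁ , y₁∉P
  ...   | yes _   | no y₂∉P = y₂ , e₂ , y₂∉P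
  ...   | yes y₁∈P | yes y₂∈P = ⊥-elim (y₁≢y₂ (len-suffixFrom-injective P y₁∈P y₂∈P
          (trans (len-suffixFrom-neighbour pathP e₁ y₁∈P) (sym (len-suffixFrom-neighbour pathP e₂ y₂∈P)))))

  LeafPathBeyond : ∀ {a b} → Walk G a b → Set
  LeafPathBeyond {a} P = ∃ λ c → IsLeaf G c × Σ (Walk G a c) λ Q → IsPath Q × len P ≤ len Q

  extend-to-leaf : (fuel : ℕ) → ∀ {a b} (P : Walk G a b) → IsPath P → 1 ≤ deg G b →
                   n ≤ len P + fuel → LeafPathBeyond P
  extend-to-leaf zero P pathP _ n≤ = ⊥-elim (<⇒≱ (path-length< pathP) (subst (n ≤_) (+-identityʳ _) n≤))
  extend-to-leaf (suc fuel) {b = b} P pathP 1≤deg n≤ with deg G b ≟ 1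
  ... | yes leaf = b , leaf , P , pathP , ≤-refl
  ... | no ¬leaf with neighbour-off-path pathP (≤∧≢⇒< 1≤deg (¬leaf ∘ sym))
  ...   | y , e , y∉P =
    let c , leaf , Q , pathQ , longer =
          extend-to-leaf fuel (snoc P e) (snoc-path e pathP y∉P) (adj⇒deg-pos G (adj-sym simple e))
            (subst (n ≤_) (trans (+-suc (len P) fuel) (cong (_+ fuel) (sym (len-snoc P e)))) n≤)
    in c , leaf , Q , pathQ , ≤-trans (n≤1+n (len P)) (subst (_≤ len Q) (len-snoc P e) longer)

  edge-extends-to-leaf : ∀ {a x} (e : Adj G a x) → LeafPathBeyond (step e (stop x))
  edge-extends-to-leaf e =
    extend-to-leaf n (step e (stop _)) (edge-path simple e) (adj⇒deg-pos G (adj-sym simple e)) (m≤n+m n 1)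

-- Leaves of trees and the degree sum

_∖_ : ∀ {m} → Graph (suc m) → Fin (suc m) → Graph m
(G ∖ c) u v = G (punchIn c u) (punchIn c v)

module _ {m} (G : Graph (suc m)) (c : Fin (suc m)) where

  ∖-simple : IsSimple G → IsSimple (G ∖ c)
  ∖-simple (symmetric , irreflexive) = (λ u v → symmetric _ _) , (λ u → irreflexive _)

  liftWalk : ∀ {a b} → Walk (G ∖ c) a b → Walk G (punchIn c a) (punchIn c b)
  liftWalk (stop a) = stop (punchIn c a)
  liftWalk (step e W) = step e (liftWalk W)

  verts-liftWalk : ∀ {a b} (W : Walk (G ∖ c) a b) → verts (liftWalk W) ≡ map (punchIn c) (verts W)
  verts-liftWalk (stop _) = refl
  verts-liftWalk (step _ W) = cong (_ ∷_) (verts-liftWalk W)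

  len-liftWalk : ∀ {a b} (W : Walk (G ∖ c) a b) → len (liftWalk W) ≡ len W
  len-liftWalk (stop _) = refl
  len-liftWalk (step _ W) = cong suc (len-liftWalk W)

  ∖-acyclic : Acyclic G → Acyclic (G ∖ c)
  ∖-acyclic acyclic u v e W pathW 2≤len =
    acyclic _ _ e (liftWalk W)
      (subst Unique (sym (verts-liftWalk W)) (Unique.map⁺ (punchIn-injective c _ _) pathW))
      (subst (2 ≤_) (sym (len-liftWalk W)) 2≤len)

  module _ (simple : IsSimple G) (leaf : IsLeaf G c) where

    -- A walk entering the leaf c must leave it through the vertex it came from.
    bypass : ∀ {x y} (W : Walk G x y) {a b} → punchIn c a ≡ x → punchIn c b ≡ y → Walk (G ∖ c) a b
    bypass (stop _) {a} {b} refl b↦a = subst (Walk (G ∖ c) a) (punchIn-injective c a b (sym b↦a)) (stop a)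
    bypass (step {v = z} e W) refl b↦y with z ≟ᶠ c
    ... | no z≢c = step (subst (Adj G _) (sym (punchIn-punchOut c≢z)) e) (bypass W (punchIn-punchOut c≢z) b↦y)
      where c≢z = z≢c ∘ sym
    bypass (step e (stop _)) refl b↦c | yes refl = ⊥-elim (punchInᵢ≢i c _ b↦c)
    bypass (step e (step e′ W)) refl b↦y | yes refl =
      bypass W (leaf-neighbour-unique G leaf (adj-sym simple e) e′) b↦y

    ∖-connected : Connected G → Connected (G ∖ c)
    ∖-connected connected a b = bypass (connected (punchIn c a) (punchIn c b)) refl refl

    deg-split : ∀ v → deg G v ≡ indicator (G v c) + ∑[ i < m ] indicator (G v (punchIn c i))
    deg-split v = trans (deg≡∑ G v) (sum-remove {i = c} (indicator ∘ G v))

    deg-punchIn : ∀ i → deg G (punchIn c i) ≡ indicator (G (punchIn c i) c) + deg (G ∖ c) i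
    deg-punchIn i = trans (deg-split (punchIn c i)) (cong (indicator (G (punchIn c i) c) +_) (sym (deg≡∑ (G ∖ c) i)))

    ∑deg-∖ : ∑[ v < suc m ] deg G v ≡ 2 + ∑[ v < m ] deg (G ∖ c) v
    ∑deg-∖ = begin
      ∑[ v < suc m ] deg G v
        ≡⟨ sum-remove {i = c} (deg G) ⟩
      deg G c + ∑[ i < m ] deg G (punchIn c i)
        ≡⟨ cong₂ _+_ leaf (sum-cong-≗ deg-punchIn) ⟩
      1 + ∑[ i < m ] (indicator (G (punchIn c i) c) + deg (G ∖ c) i)
        ≡⟨ cong (1 +_) (∑-distrib-+ (λ i → indicator (G (punchIn c i) c)) (deg (G ∖ c))) ⟩
      1 + (∑[ i < m ] indicator (G (punchIn c i) c) + ∑[ i < m ] deg (G ∖ c) i)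
        ≡⟨ cong (λ k → 1 + (k + ∑[ i < m ] deg (G ∖ c) i)) edges-at-c ⟩
      2 + ∑[ i < m ] deg (G ∖ c) i ∎
      where
      open ≡-Reasoning
      edges-at-c : ∑[ i < m ] indicator (G (punchIn c i) c) ≡ 1
      edges-at-c = begin
        ∑[ i < m ] indicator (G (punchIn c i) c)
          ≡⟨ sum-cong-≗ (λ i → cong indicator (proj₁ simple (punchIn c i) c)) ⟩
        ∑[ i < m ] indicator (G c (punchIn c i))
          ≡⟨ cong (λ b → indicator b + ∑[ i < m ] indicator (G c (punchIn c i))) (proj₂ simple c) ⟨
        indicator (G c c) + ∑[ i < m ] indicator (G c (punchIn c i))
          ≡⟨ trans (sym (deg-split c)) leaf ⟩
        1 ∎

tree-has-leaf : ∀ {m} (G : Graph (suc (suc m))) → IsTree G → ∃ (IsLeaf G)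
tree-has-leaf G (simple , connected , acyclic)
  with x , e ← walk⇒neighbour (connected zero (suc zero)) (λ ())
  with c , leaf , _ ← edge-extends-to-leaf simple acyclic e = c , leaf

∖-tree : ∀ {m} (G : Graph (suc m)) {c} → IsLeaf G c → IsTree G → IsTree (G ∖ c)
∖-tree G {c} leaf (simple , connected , acyclic) =
  ∖-simple G c simple , ∖-connected G c simple leaf connected , ∖-acyclic G c acyclic

∑deg-tree : ∀ {m} (G : Graph (suc m)) → IsTree G → ∑[ v < suc m ] deg G v ≡ 2 * m
∑deg-tree {zero} G ((_ , irreflexive) , _) rewrite irreflexive zero = refl
∑deg-tree {suc m} G tree with c , leaf ← tree-has-leaf G tree = begin
  ∑[ v < suc (suc m) ] deg G v  ≡⟨ ∑deg-∖ G c (proj₁ tree) leaf ⟩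
  2 + ∑[ v < suc m ] deg (G ∖ c) v ≡⟨ cong (2 +_) (∑deg-tree (G ∖ c) (∖-tree G leaf tree)) ⟩
  2 + 2 * m                     ≡⟨ *-suc 2 m ⟨
  2 * suc m                     ∎
  where open ≡-Reasoning

∑deg-tree-≤ : ∀ {n} (G : Graph n) → IsTree G → ∑[ v < n ] deg G v ≤ 2 * n
∑deg-tree-≤ {zero} G _ = z≤n
∑deg-tree-≤ {suc m} G tree = subst (_≤ 2 * suc m) (sym (∑deg-tree G tree)) (*-monoʳ-≤ 2 (n≤1+n m))

-- Counting subgraphs by their values on darts

SupportedOn : ∀ {n} → List (Fin n × Fin n) → Graph n → Set
SupportedOn E S = ∀ u v → Adj S u v → (u , v) ∈ E

valuesOn : ∀ {n} → List (Fin n × Fin n) → Graph n → List Bool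
valuesOn E S = map (uncurry S) E

different⇒adj : ∀ {n} (S S′ : Graph n) {u v} → S u v ≢ S′ u v → Adj S u v ⊎ Adj S′ u v
different⇒adj S S′ {u} {v} S≢S′ with S u v | S′ u v
... | true  | _     = inj₁ refl
... | false | true  = inj₂ refl
... | false | false = ⊥-elim (S≢S′ refl)

valuesOn-≢ : ∀ {n} (E : List (Fin n × Fin n)) {S S′} → SupportedOn E S → SupportedOn E S′ →
             DifferentGraphs S S′ → valuesOn E S ≢ valuesOn E S′
valuesOn-≢ E {S} {S′} supp supp′ (u , v , S≢S′) eq =
  S≢S′ (map-≡⇒≗ E eq ([ supp u v , supp′ u v ]′ (different⇒adj S S′ S≢S′)))

count-supported-subgraphs : ∀ {n} (E : List (Fin n × Fin n)) (L : List (Graph n)) →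
                            AllPairs DifferentGraphs L → All (SupportedOn E) L → length L ≤ 2 ^ length E
count-supported-subgraphs E L distinct supported =
  subst (_≤ 2 ^ length E) (length-map (valuesOn E) L)
    (Unique-bitStrings-≤ (length E) (unique L distinct supported)
      (All.map⁺ (All.tabulate (λ {S} _ → length-map (uncurry S) E))))
  where
  unique : ∀ L → AllPairs DifferentGraphs L → All (SupportedOn E) L → Unique (map (valuesOn E) L)
  unique [] [] [] = []
  unique (S ∷ L) (S≢L ∷ distinct) (supp ∷ supported) =
    All.map⁺ (All.zipWith (λ (S≢S′ , supp′) → valuesOn-≢ E supp supp′ S≢S′) (S≢L , supported))
    ∷ unique L distinct supported

darts : ∀ {n} → Graph n → List (Fin n × Fin n)
darts {n} G = concatMap (λ u → map (u ,_) (neighbours G u)) (allFin n)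

length-darts : ∀ {n} (G : Graph n) → length (darts G) ≡ ∑[ v < n ] deg G v
length-darts {n} G = begin
  length (darts G)                                         ≡⟨ length-concatMap _ (allFin n) ⟩
  List.sum (map (λ u → length (map (u ,_) (neighbours G u))) (allFin n))
    ≡⟨ cong List.sum (map-cong (λ u → trans (length-map _ (neighbours G u)) (length-neighbours G u)) (allFin n)) ⟩
  List.sum (map (deg G) (allFin n))                        ≡⟨ sum-allFin (deg G) ⟩
  ∑[ v < n ] deg G v                                       ∎
  where open ≡-Reasoning

∈-darts : ∀ {n} {G : Graph n} {u v} → Adj G u v → (u , v) ∈ darts G
∈-darts {G = G} {u} e = ∈-concatMap⁺ (λ u → map (u ,_) (neighbours G u))
  (lose (∈-allFin u) (∈-map⁺ (u ,_) (∈-neighbours⁺ G e)))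

cycleDarts : ∀ {n p} → (Fin p → Fin n) → List (Fin n × Fin n)
cycleDarts {p = p} ℓ = map (λ i → ℓ i , ℓ (next i)) (allFin p) ++ map (λ i → ℓ (next i) , ℓ i) (allFin p)

∈-cycleDarts : ∀ {n p} {ℓ : Fin p → Fin n} {u v} → Adj (cycleAdj ℓ) u v → (u , v) ∈ cycleDarts ℓ
∈-cycleDarts {p = p} {ℓ} {u} {v} e =
  let i , found = Any.satisfied (any⁻ _ (allFin p) (Equivalence.from T-≡ e))
  in [ forward i , backward i ]′ (Equivalence.to T-∨ found)
  where
  forward : ∀ i → T (eqᵇ u (ℓ i) ∧ eqᵇ v (ℓ (next i))) → (u , v) ∈ cycleDarts ℓ
  forward i t with u≡ , v≡ ← Equivalence.to T-∧ t =
    subst₂ (λ x y → (x , y) ∈ cycleDarts ℓ)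
      (sym (toWitness {a? = u ≟ᶠ ℓ i} u≡)) (sym (toWitness {a? = v ≟ᶠ ℓ (next i)} v≡))
      (∈-++⁺ˡ (∈-map⁺ _ (∈-allFin i)))
  backward : ∀ i → T (eqᵇ v (ℓ i) ∧ eqᵇ u (ℓ (next i))) → (u , v) ∈ cycleDarts ℓ
  backward i t with v≡ , u≡ ← Equivalence.to T-∧ t =
    subst₂ (λ x y → (x , y) ∈ cycleDarts ℓ)
      (sym (toWitness {a? = u ≟ᶠ ℓ (next i)} u≡)) (sym (toWitness {a? = v ≟ᶠ ℓ i} v≡))
      (∈-++⁺ʳ _ (∈-map⁺ _ (∈-allFin i)))

halinDarts : ∀ {n p} → Graph n → (Fin p → Fin n) → List (Fin n × Fin n)
halinDarts T ℓ = darts T ++ cycleDarts ℓ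

∈-halinDarts : ∀ {n p} (T : Graph n) (ℓ : Fin p → Fin n) → SupportedOn (halinDarts T ℓ) (halin T ℓ)
∈-halinDarts T ℓ u v e with T u v in uv
... | true  = ∈-++⁺ˡ (∈-darts uv)
... | false = ∈-++⁺ʳ (darts T) (∈-cycleDarts {ℓ = ℓ} e)

length-cycleDarts : ∀ {n p} (ℓ : Fin p → Fin n) → length (cycleDarts ℓ) ≡ p + p
length-cycleDarts {p = p} ℓ =
  trans (length-++ (map forward (allFin p))) (cong₂ _+_ (length-allFin forward) (length-allFin backward))
  where
  forward backward : Fin p → _
  forward i = ℓ i , ℓ (next i)
  backward i = ℓ (next i) , ℓ i
  length-allFin : ∀ {A : Set} (f : Fin p → A) → length (map f (allFin p)) ≡ p
  length-allFin f = trans (length-map f (allFin p)) (length-tabulate id)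

length-halinDarts : ∀ {n p} (T : Graph n) (ℓ : Fin p → Fin n) →
                    length (halinDarts T ℓ) ≡ ∑[ v < n ] deg T v + (p + p)
length-halinDarts T ℓ = trans (length-++ (darts T)) (cong₂ _+_ (length-darts T) (length-cycleDarts ℓ))

leaves : ∀ {n} → Graph n → List (Fin n)
leaves {n} G = filterᵇ (λ v → deg G v ≡ᵇ 1) (allFin n)

length-leaves : ∀ {n} (G : Graph n) → length (leaves G) ≡ ∑[ v < n ] indicator (deg G v ≡ᵇ 1)
length-leaves {n} G = trans (length-filterᵇ _ (allFin n)) (sum-allFin (λ v → indicator (deg G v ≡ᵇ 1)))

length-leaves-≤ : ∀ {n p} (G : Graph n) (ℓ : Fin p → Fin n) →
                  (∀ v → IsLeaf G v → ∃ λ i → ℓ i ≡ v) → length (leaves G) ≤ p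
length-leaves-≤ {n} {p} G ℓ leaf⇒ℓ =
  subst (length (leaves G) ≤_) (trans (length-map ℓ (allFin p)) (length-tabulate id))
    (Unique-length-≤ (Unique.filter⁺ isLeaf? (Unique.allFin⁺ n)) leaves⊆ℓ)
  where
  isLeaf? = T? ∘ (_≡ᵇ 1) ∘ deg G
  leaves⊆ℓ : leaves G ⊆ map ℓ (allFin p)
  leaves⊆ℓ {v} v∈ with i , refl ← leaf⇒ℓ v (≡ᵇ⇒≡ _ 1 (proj₂ (∈-filter⁻ isLeaf? {xs = allFin n} v∈))) =
    ∈-map⁺ ℓ (∈-allFin i)

3≤deg+2·leaf : ∀ k → 1 ≤ k → k ≢ 2 → 3 ≤ k + (indicator (k ≡ᵇ 1) + indicator (k ≡ᵇ 1))
3≤deg+2·leaf 1 _ _ = ≤-refl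
3≤deg+2·leaf 2 _ k≢2 = ⊥-elim (k≢2 refl)
3≤deg+2·leaf (suc (suc (suc k))) _ _ = s≤s (s≤s (s≤s z≤n))

3n≤∑deg+2leaves : ∀ {n} (G : Graph n) → (∀ v → 1 ≤ deg G v) → (∀ v → deg G v ≢ 2) →
                  3 * n ≤ ∑[ v < n ] deg G v + (length (leaves G) + length (leaves G))
3n≤∑deg+2leaves {n} G 1≤deg deg≢2 = begin
  3 * n                                      ≡⟨ trans (*-comm 3 n) (sym (∑-const n 3)) ⟩
  ∑[ v < n ] 3                               ≤⟨ ∑-mono-≤ (λ v → 3≤deg+2·leaf (deg G v) (1≤deg v) (deg≢2 v)) ⟩
  ∑[ v < n ] (deg G v + (isLeaf v + isLeaf v))
    ≡⟨ ∑-distrib-+ (deg G) (λ v → isLeaf v + isLeaf v) ⟩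
  ∑[ v < n ] deg G v + ∑[ v < n ] (isLeaf v + isLeaf v)
    ≡⟨ cong (∑[ v < n ] deg G v +_) (∑-distrib-+ isLeaf isLeaf) ⟩
  ∑[ v < n ] deg G v + (∑[ v < n ] isLeaf v + ∑[ v < n ] isLeaf v)
    ≡⟨ cong (λ k → ∑[ v < n ] deg G v + (k + k)) (length-leaves G) ⟨
  ∑[ v < n ] deg G v + (length (leaves G) + length (leaves G)) ∎
  where
  open ≤-Reasoning
  isLeaf : Fin n → ℕ
  isLeaf v = indicator (deg G v ≡ᵇ 1)

D≤2n∧3n≤D+2p⇒D≤4p : ∀ {n p D} → D ≤ 2 * n → 3 * n ≤ D + (p + p) → D ≤ 4 * p
D≤2n∧3n≤D+2p⇒D≤4p {n} {p} {D} D≤2n 3n≤ = begin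
  D            ≤⟨ D≤2n ⟩
  2 * n        ≤⟨ *-monoʳ-≤ 2 n≤2p ⟩
  2 * (2 * p)  ≡⟨ *-assoc 2 2 p ⟨
  4 * p        ∎
  where
  open ≤-Reasoning
  rearrange : ∀ n p → 2 * n + (p + p) ≡ 2 * p + 2 * n
  rearrange = solve-∀
  n≤2p : n ≤ 2 * p
  n≤2p = +-cancelʳ-≤ (2 * n) n (2 * p) (begin
    n + 2 * n      ≤⟨ 3n≤ ⟩
    D + (p + p)    ≤⟨ +-monoˡ-≤ (p + p) D≤2n ⟩
    2 * n + (p + p) ≡⟨ rearrange n p ⟩
    2 * p + 2 * n  ∎)

halin-other-vertex : ∀ {n p} {T : Graph n} {ℓ : Fin p → Fin n} → IsHalinFrame T ℓ →
                     ∀ v → ∃ λ (w : Fin n) → v ≢ w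
halin-other-vertex {ℓ = ℓ} (_ , _ , s≤s (s≤s _) , ℓ-injective , _) v with v ≟ᶠ ℓ zero
... | yes v≡ℓ0 = ℓ (suc zero) , λ v≡ℓ1 → case ℓ-injective zero (suc zero) (trans (sym v≡ℓ0) v≡ℓ1) of λ ()
... | no v≢ℓ0  = ℓ zero , v≢ℓ0

halin-deg-pos : ∀ {n p} {T : Graph n} {ℓ : Fin p → Fin n} → IsHalinFrame T ℓ → ∀ v → 1 ≤ deg T v
halin-deg-pos {T = T} frame@((_ , connected , _) , _) v =
  let w , v≢w = halin-other-vertex frame v
      _ , e = walk⇒neighbour (connected v w) v≢w
  in adj⇒deg-pos T e

halin-∑deg≤4p : ∀ {n p} {T : Graph n} {ℓ : Fin p → Fin n} → IsHalinFrame T ℓ →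
                ∑[ v < n ] deg T v ≤ 4 * p
halin-∑deg≤4p {n} {p} {T} {ℓ} frame@(tree , no-deg-2 , _ , _ , _ , leaf⇒ℓ , _) =
  D≤2n∧3n≤D+2p⇒D≤4p {n} {p} (∑deg-tree-≤ T tree)
    (≤-trans (3n≤∑deg+2leaves T (halin-deg-pos frame) no-deg-2)
      (+-monoʳ-≤ (∑[ v < n ] deg T v) (+-mono-≤ #leaves≤p #leaves≤p)))
  where #leaves≤p = length-leaves-≤ T ℓ leaf⇒ℓ

halin-depth-pos : ∀ {n p} {T : Graph n} {ℓ : Fin p → Fin n} → IsHalinFrame T ℓ →
                  ∀ {r d} → Depth T r d → 1 ≤ d
halin-depth-pos frame@((simple , connected , acyclic) , _) {r} (paths≤d , _) =
  let w , r≢w = halin-other-vertex frame r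
      _ , e = walk⇒neighbour (connected r w) r≢w
      c , leaf , Q , pathQ , 1≤len = edge-extends-to-leaf simple acyclic e
  in ≤-trans 1≤len (paths≤d c leaf Q pathQ)

count-halin-subgraphs : ∀ {n p} (T : Graph n) (ℓ : Fin p → Fin n) (L : List (Graph n)) →
                        AllPairs DifferentGraphs L → All (IsSpanningTreeOf (halin T ℓ)) L →
                        length L ≤ 2 ^ (∑[ v < n ] deg T v + (p + p))
count-halin-subgraphs T ℓ L distinct spanning =
  subst (λ k → length L ≤ 2 ^ k) (length-halinDarts T ℓ)
    (count-supported-subgraphs (halinDarts T ℓ) L distinct
      (All.map (λ (S⊆H , _) u v e → ∈-halinDarts T ℓ u v (S⊆H u v e)) spanning))

2^[D+2p]≤64^p : ∀ {D p} → D ≤ 4 * p → 2 ^ (D + (p + p)) ≤ 64 ^ p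
2^[D+2p]≤64^p {D} {p} D≤4p = begin
  2 ^ (D + (p + p))      ≤⟨ ^-monoʳ-≤ 2 (+-monoˡ-≤ (p + p) D≤4p) ⟩
  2 ^ (4 * p + (p + p))  ≡⟨ cong (2 ^_) (six p) ⟩
  2 ^ (6 * p)            ≡⟨ ^-*-assoc 2 6 p ⟨
  64 ^ p                 ∎
  where
  open ≤-Reasoning
  six : ∀ p → 4 * p + (p + p) ≡ 6 * p
  six = solve-∀

-- Kept abstract so that the type checker never unfolds this 193-bit number.
abstract
  C : ℕ
  C = 64 ^ 32

  1≤C : 1 ≤ C
  1≤C = m^n>0 64 32

  64^p≤C : ∀ {p} → p ≤ 32 → 64 ^ p ≤ C
  64^p≤C p≤32 = ^-monoʳ-≤ 64 p≤32

64^p≤C*[2pd]^p : ∀ {p d} → 1 ≤ p → 1 ≤ d → 64 ^ p ≤ C * (2 * p * d) ^ p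
64^p≤C*[2pd]^p {p} {d} 1≤p 1≤d with p ≤? 32
... | yes p≤32 = ≤-trans (64^p≤C p≤32) (m≤m*n C ((2 * p * d) ^ p) {{>-nonZero 1≤[2pd]^p}})
  where
  1≤2pd : 1 ≤ 2 * p * d
  1≤2pd = *-mono-≤ {1} {2 * p} {1} {d} (*-mono-≤ {1} {2} {1} {p} (s≤s z≤n) 1≤p) 1≤d
  1≤[2pd]^p : 1 ≤ (2 * p * d) ^ p
  1≤[2pd]^p = m^n>0 (2 * p * d) {{>-nonZero 1≤2pd}} p
... | no p≰32 = ≤-trans (^-monoˡ-≤ p 64≤2pd) (m≤n*m ((2 * p * d) ^ p) C {{>-nonZero 1≤C}})
  where
  64≤2pd : 64 ≤ 2 * p * d
  64≤2pd = *-mono-≤ {64} {2 * p} {1} {d} (≤-trans (m≤n+m 64 2) (*-monoʳ-≤ 2 (≰⇒> p≰32))) 1≤d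

theorem3 : Σ ℕ λ c → 1 ≤ c ×
    (∀ n p (T : Graph n) (ℓ : Fin p → Fin n) → IsHalinFrame T ℓ →
    ∀ r d → Depth T r d →
    (L : List (Graph n)) → AllPairs DifferentGraphs L →
    All (IsSpanningTreeOf (halin T ℓ)) L →
    length L ≤ c * (2 * p * d) ^ p)
theorem3 = C , 1≤C ,
  λ { n p T ℓ frame@(_ , _ , 3≤p , _) r d depth L distinct spanning → begin
    length L                            ≤⟨ count-halin-subgraphs T ℓ L distinct spanning ⟩
    2 ^ (∑[ v < n ] deg T v + (p + p))  ≤⟨ 2^[D+2p]≤64^p {p = p} (halin-∑deg≤4p frame) ⟩
    64 ^ p                              ≤⟨ 64^p≤C*[2pd]^p (≤-trans (s≤s z≤n) 3≤p) (halin-depth-pos frame depth) ⟩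
    C * (2 * p * d) ^ p                 ∎ }
  where open ≤-Reasoning
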